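{- Let $t,s,\ell,r$ be positive integers with $s<t$, let $\vec B=(B_1,\dots,B_s)$, and let $\mathcal{G}$ be a $(t,s,\ell,\vec B)$-weak-builder satisfying \[\frac{B_s-\ell}{\binom ts\ell}\ge\frac{1}{1-2^{ -1/r}}.\] Then $\mathcal{G}$ is a $(t,s,\ell,r,\tfrac12\vec B)$-strong-builder.
   Context: A $t$-complex $\mathcal{G}$ is a collection of nonempty sets of size at most $t$ closed under taking nonempty subsets; $\mathcal{G}_i$ is the set of members of size $i$; $V(\mathcal{G})$ is the union of its members; $\deg_{\mathcal{G}}(K)$ is the number of members of $\mathcal{G}_t$ containing $K$. For $S\subseteq V(\mathcal{G})$, $\mathcal{G}\setminus S=\{K\setminus S: K\in\mathcal{G},\ K\not\subseteq S\}$. A $t$-complex $\mathcal{G}$ is a $(t,s,\ell,\vec B)$-weak-builder (with $s<t$, $\vec B\in\mathbb{N}^s$) if (1) for every $1\le i\le s$ and every $K\in\mathcal{G}_i$, $\deg_{\mathcal{G}}(K)\ge B_i$, and (2) for every $K\in\mathcal{G}_{s+1}$, $\deg_{\mathcal{G}}(K)\le\ell$. It is a $(t,s,\ell,r,\vec B)$-strong-builder if for every $S\subseteq V(\mathcal{G})$ with $|S|\le r$, $\mathcal{G}\setminus S$ is a $(t,s,\ell,\vec B)$-weak-builder. -}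

module Defs where

open import Data.Nat using (ℕ; zero; suc; _+_; _*_; _≤_; _<_; _≟_)
open import Data.Bool using (Bool; true; false; _∧_; not)
open import Data.Fin using (Fin; toℕ)
open import Data.Fin.Subset using (Subset; inside; outside; _⊆_; _∈_; ∣_∣; Nonempty; _─_)
open import Data.Fin.Subset.Properties using (_⊆?_)
open import Data.List using (List; []; _∷_; _++_; map)
open import Data.Vec using (Vec; lookup; last)
import Data.Vec.Properties as VecP
import Data.Bool.Properties as BoolP
open import Data.Product using (Σ; _×_; ∃)
open import Relation.Nullary.Decidable using (⌊_⌋)
open import Relation.Binary.PropositionalEquality using (_≡_)

-- A (finite) family of subsets of the vertex set Fin n, given by its
-- decidable membership function: K is a member iff G K ≡ true.
Family : ℕ → Set
Family n = Subset n → Bool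

allSubsets : ∀ n → List (Subset n)
allSubsets zero = Data.Vec.[] ∷ []
allSubsets (suc n) = map (outside Data.Vec.∷_) (allSubsets n) ++ map (inside Data.Vec.∷_) (allSubsets n)

countB : ∀ {A : Set} → (A → Bool) → List A → ℕ
countB p [] = 0
countB p (x ∷ xs) with p x
... | true  = suc (countB p xs)
... | false = countB p xs

anyB : ∀ {A : Set} → (A → Bool) → List A → Bool
anyB p [] = false
anyB p (x ∷ xs) with p x
... | true  = true
... | false = anyB p xs

IsComplex : ∀ {n} → ℕ → Family n → Set
IsComplex t G = ∀ K → G K ≡ true →
  Nonempty K × ∣ K ∣ ≤ t × (∀ L → Nonempty L → L ⊆ K → G L ≡ true)

deg : ∀ {n} → ℕ → Family n → Subset n → ℕ
deg {n} t G K = countB (λ L → G L ∧ ⌊ ∣ L ∣ ≟ t ⌋ ∧ ⌊ K ⊆? L ⌋) (allSubsets n)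

InV : ∀ {n} → Family n → Fin n → Set
InV G x = ∃ λ K → G K ≡ true × x ∈ K

_⊆V_ : ∀ {n} → Subset n → Family n → Set
S ⊆V G = ∀ x → x ∈ S → InV G x

-- G \ S = { K \ S : K ∈ G, K ⊄ S }.
_∖_ : ∀ {n} → Family n → Subset n → Family n
_∖_ {n} G S L = anyB (λ K → G K ∧ not ⌊ K ⊆? S ⌋ ∧ ⌊ VecP.≡-dec BoolP._≟_ (K ─ S) L ⌋) (allSubsets n)

-- (t,s,ℓ,(1/d)·B)-weak-builder: the threshold B_i is scaled by 1/d,
-- i.e. condition (1) reads deg(K) ≥ B_i / d, stated as B_i ≤ d * deg(K).
-- The paper's (t,s,ℓ,B)-weak-builder is the case d = 1.
-- Index i : Fin s stands for the size toℕ i + 1 ∈ {1,…,s}.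
WeakBuilderScaled : ∀ {n} (t s ℓ : ℕ) → Vec ℕ s → (d : ℕ) → Family n → Set
WeakBuilderScaled t s ℓ B d G =
  IsComplex t G
  × (∀ (i : Fin s) K → G K ≡ true → ∣ K ∣ ≡ suc (toℕ i) → lookup B i ≤ d * deg t G K)
  × (∀ K → G K ≡ true → ∣ K ∣ ≡ suc s → deg t G K ≤ ℓ)

WeakBuilder : ∀ {n} (t s ℓ : ℕ) → Vec ℕ s → Family n → Set
WeakBuilder t s ℓ B G = WeakBuilderScaled t s ℓ B 1 G

StrongBuilderScaled : ∀ {n} (t s ℓ r : ℕ) → Vec ℕ s → (d : ℕ) → Family n → Set
StrongBuilderScaled t s ℓ r B d G =
  ∀ S → S ⊆V G → ∣ S ∣ ≤ r → WeakBuilderScaled t s ℓ B d (G ∖ S)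

lastEntry : ∀ {s} → 0 < s → Vec ℕ s → ℕ
lastEntry {suc k} _ B = last B

{-# OPTIONS --safe #-}

-- Delete the vertices v₁, …, vₘ of S (m ≤ r) one at a time and let Nⱼ(K) count the t-edges
-- through K avoiding v₁, …, vⱼ. Put D = B_s − ℓ and a = C(t,s)·ℓ. Every s-set J ⊇ K of G still
-- lies in at least D − jℓ of these t-edges, since each deleted vertex v kills at most
-- deg(J ∪ {v}) ≤ ℓ of them. Double counting the pairs J ⊆ T of s-sets and t-edges above K, and
-- the t-edges through vⱼ₊₁ via the (s+1)-sets J ∪ {vⱼ₊₁}, shows that one more deletion destroys
-- at most (a/D)·Nⱼ(K) edges. Hence deg_{G∖S}(K) ≥ Nₘ(K) ≥ (1 − a/D)ᵐ deg_G(K) ≥ deg_G(K)/2 by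
-- the hypothesis (D/(D − a))ʳ ≤ 2, which by Bernoulli's inequality also gives ra ≤ D − a,
-- keeping D − jℓ large enough at every step.
module Submission where

open import Defs
open import Data.Nat using (ℕ; _*_; _∸_; _^_; _≤_; _<_)
open import Data.Nat.Combinatorics using (_C_)
open import Data.Vec using (Vec)

import Algebra.Properties.CommutativeSemigroup as CommSemigroup
open import Data.Bool using (Bool; true; false; T; not; _∧_; if_then_else_)
import Data.Bool.Properties as Bool
open import Data.Empty using (⊥-elim)
open import Data.Fin using (Fin; toℕ; fromℕ) renaming (zero to fzero; suc to fsuc)
open import Data.Fin.Properties using (toℕ-fromℕ; toℕ<n)
open import Data.Fin.Subset using (Subset; inside; outside; _⊆_; _∈_; _∉_; ∣_∣; Nonempty; _─_; _∪_; ⁅_⁆; _-_; ∁)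
open import Data.Fin.Subset.Properties
open import Data.List using (List; []; _∷_; _++_; map; length)
open import Data.List.Properties using (map-cong; length-map)
open import Data.List.Membership.Propositional using () renaming (_∈_ to _∈ₗ_)
open import Data.List.Membership.Propositional.Properties using (∈-map⁺; ∈-map⁻; ∈-++⁺ˡ; ∈-++⁺ʳ)
open import Data.List.Relation.Unary.All as All using (All; all?; []; _∷_)
open import Data.List.Relation.Unary.Any using (here; there)
open import Data.Nat using (zero; suc; _+_; z≤n; s≤s; >-nonZero)
open import Data.Nat.Combinatorics using (nCk+nC[k+1]≡[n+1]C[k+1]; nC1≡n)
open import Data.Nat.ListAction using (sum)
open import Data.Nat.Properties
open import Data.Nat.Tactic.RingSolver using (solve-∀)
open import Data.Product using (∃; _×_; _,_; proj₁; proj₂)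
open import Data.Product.Function.NonDependent.Propositional using (_×-⇔_)
open import Data.Sum using (inj₁; inj₂)
open import Data.Vec using (lookup; last; _∷_; []; here; there)
import Data.Vec.Properties as Vec
open import Function using (_∘_; flip; case_of_)
open import Function.Bundles using (_⇔_; mk⇔; Equivalence)
open import Function.Properties.Equivalence using () renaming (refl to ⇔-refl)
open import Level using (Level; 0ℓ)
open import Relation.Binary using (REL) renaming (Decidable to Decidable₂)
open import Relation.Binary.PropositionalEquality
open import Relation.Nullary using (Dec; ¬_; ¬?; yes; no; contradiction; _×-dec_)
open import Relation.Nullary.Decidable using (⌊_⌋; toWitness; fromWitness; decidable-stable)
open import Relation.Unary using (Pred; Decidable)
open import Relation.Unary.Properties using (_∩?_; ∁?)

open CommSemigroup +-commutativeSemigroup using () renaming (interchange to +-interchange)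
open CommSemigroup *-commutativeSemigroup using (x∙yz≈y∙xz; xy∙z≈y∙xz)

private variable
  p q r : Level
  A B : Set
  n : ℕ

-- Counting

countB-mono : ∀ {f g : A → Bool} → (∀ {x} → T (f x) → T (g x)) → ∀ xs → countB f xs ≤ countB g xs
countB-mono f⇒g [] = z≤n
countB-mono {f = f} {g} f⇒g (x ∷ xs) with f x in fx | g x in gx
... | true  | true  = s≤s (countB-mono f⇒g xs)
... | true  | false = ⊥-elim (subst T gx (f⇒g (subst T (sym fx) _)))
... | false | true  = m≤n⇒m≤1+n (countB-mono f⇒g xs)
... | false | false = countB-mono f⇒g xs

countB-cong : ∀ {f g : A → Bool} → (∀ x → f x ≡ g x) → ∀ xs → countB f xs ≡ countB g xs
countB-cong f≗g xs = ≤-antisym (countB-mono (λ {x} → subst T (f≗g x)) xs) (countB-mono (λ {x} → subst T (sym (f≗g x))) xs)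

#[_] : {P : Pred A p} → Decidable P → List A → ℕ
#[ P? ] = countB (λ x → ⌊ P? x ⌋)

#-mono : {P : Pred A p} {Q : Pred A q} (P? : Decidable P) (Q? : Decidable Q) → (∀ {x} → P x → Q x) →
         ∀ xs → #[ P? ] xs ≤ #[ Q? ] xs
#-mono P? Q? P⊆Q = countB-mono (fromWitness ∘ P⊆Q ∘ toWitness)

#-cong : {P : Pred A p} {Q : Pred A q} (P? : Decidable P) (Q? : Decidable Q) → (∀ {x} → P x ⇔ Q x) →
         ∀ xs → #[ P? ] xs ≡ #[ Q? ] xs
#-cong P? Q? P⇔Q xs = ≤-antisym (#-mono P? Q? (Equivalence.to P⇔Q) xs) (#-mono Q? P? (Equivalence.from P⇔Q) xs)

module _ {P : Pred A p} (P? : Decidable P) where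

  #-none : (∀ {x} → ¬ P x) → ∀ xs → #[ P? ] xs ≡ 0
  #-none ¬P [] = refl
  #-none ¬P (x ∷ xs) with P? x
  ... | yes px = contradiction px ¬P
  ... | no  _  = #-none ¬P xs

  #-witness : ∀ xs → 0 < #[ P? ] xs → ∃ P
  #-witness (x ∷ xs) pos with P? x
  ... | yes px = x , px
  ... | no  _  = #-witness xs pos

  #-++ : ∀ xs ys → #[ P? ] (xs ++ ys) ≡ #[ P? ] xs + #[ P? ] ys
  #-++ [] ys = refl
  #-++ (x ∷ xs) ys with P? x
  ... | yes _ = cong suc (#-++ xs ys)
  ... | no  _ = #-++ xs ys

  #-split : {Q : Pred A q} (Q? : Decidable Q) → ∀ xs → #[ P? ] xs ≡ #[ P? ∩? Q? ] xs + #[ P? ∩? ∁? Q? ] xs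
  #-split Q? [] = refl
  #-split Q? (x ∷ xs) with P? x | Q? x
  ... | yes _ | yes _ = cong suc (#-split Q? xs)
  ... | yes _ | no  _ = trans (cong suc (#-split Q? xs)) (sym (+-suc _ _))
  ... | no  _ | yes _ = #-split Q? xs
  ... | no  _ | no  _ = #-split Q? xs

#-map : {P : Pred B p} (P? : Decidable P) (f : A → B) → ∀ xs → #[ P? ] (map f xs) ≡ #[ P? ∘ f ] xs
#-map P? f [] = refl
#-map P? f (x ∷ xs) with P? (f x)
... | yes _ = cong suc (#-map P? f xs)
... | no  _ = #-map P? f xs

module _ {P : Pred A p} (P? : Decidable P) (f : A → ℕ) where

  *-#-≤-sum : ∀ {c} → (∀ {x} → P x → c ≤ f x) → ∀ xs → c * #[ P? ] xs ≤ sum (map f xs)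
  *-#-≤-sum {c} c≤f [] = ≤-reflexive (*-zeroʳ c)
  *-#-≤-sum {c} c≤f (x ∷ xs) with P? x
  ... | yes px = begin
    c * suc (#[ P? ] xs)       ≡⟨ *-suc c _ ⟩
    c + c * #[ P? ] xs         ≤⟨ +-mono-≤ (c≤f px) (*-#-≤-sum c≤f xs) ⟩
    f x + sum (map f xs)       ∎
    where open ≤-Reasoning
  ... | no  _  = ≤-trans (*-#-≤-sum c≤f xs) (m≤n+m _ (f x))

  sum-≤-*-# : ∀ {d} → (∀ {x} → P x → f x ≤ d) → (∀ {x} → ¬ P x → f x ≡ 0) →
              ∀ xs → sum (map f xs) ≤ d * #[ P? ] xs
  sum-≤-*-# {d} f≤d f≡0 [] = ≤-reflexive (sym (*-zeroʳ d))
  sum-≤-*-# {d} f≤d f≡0 (x ∷ xs) with P? x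
  ... | yes px = begin
    f x + sum (map f xs)       ≤⟨ +-mono-≤ (f≤d px) (sum-≤-*-# f≤d f≡0 xs) ⟩
    d + d * #[ P? ] xs         ≡⟨ *-suc d _ ⟨
    d * suc (#[ P? ] xs)       ∎
    where open ≤-Reasoning
  ... | no ¬px = ≤-trans (≤-reflexive (cong (_+ sum (map f xs)) (f≡0 ¬px))) (sum-≤-*-# f≤d f≡0 xs)

sum-map-+ : (f g : A → ℕ) → ∀ xs → sum (map (λ x → f x + g x) xs) ≡ sum (map f xs) + sum (map g xs)
sum-map-+ f g [] = refl
sum-map-+ f g (x ∷ xs) = begin
  f x + g x + sum (map (λ x → f x + g x) xs)       ≡⟨ cong (f x + g x +_) (sum-map-+ f g xs) ⟩
  f x + g x + (sum (map f xs) + sum (map g xs))     ≡⟨ +-interchange (f x) (g x) _ _ ⟩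
  f x + sum (map f xs) + (g x + sum (map g xs))     ∎
  where open ≡-Reasoning

sum-map-swap : (F : A → B → ℕ) → ∀ xs ys →
  sum (map (λ x → sum (map (F x) ys)) xs) ≡ sum (map (λ y → sum (map (λ x → F x y) xs)) ys)
sum-map-swap F [] ys = sym (sum-map-0 ys)
  where
  sum-map-0 : ∀ ys → sum (map (λ _ → 0) ys) ≡ 0
  sum-map-0 [] = refl
  sum-map-0 (_ ∷ ys) = sum-map-0 ys
sum-map-swap F (x ∷ xs) ys = begin
  sum (map (F x) ys) + sum (map (λ x → sum (map (F x) ys)) xs)
    ≡⟨ cong (sum (map (F x) ys) +_) (sum-map-swap F xs ys) ⟩
  sum (map (F x) ys) + sum (map (λ y → sum (map (λ x → F x y) xs)) ys)
    ≡⟨ sum-map-+ (F x) (λ y → sum (map (λ x → F x y) xs)) ys ⟨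
  sum (map (λ y → F x y + sum (map (λ x → F x y) xs)) ys) ∎
  where open ≡-Reasoning

#-as-sum : {P : Pred A p} (P? : Decidable P) → ∀ xs → #[ P? ] xs ≡ sum (map (λ x → if ⌊ P? x ⌋ then 1 else 0) xs)
#-as-sum P? [] = refl
#-as-sum P? (x ∷ xs) with P? x
... | yes _ = cong suc (#-as-sum P? xs)
... | no  _ = #-as-sum P? xs

double-counting : {P : Pred A p} {Q : Pred B q} {R : REL A B r}
  (P? : Decidable P) (Q? : Decidable Q) (R? : Decidable₂ R) (xs : List A) (ys : List B) {c d : ℕ} →
  (∀ {x y} → R x y → Q y) →
  (∀ {x} → P x → c ≤ #[ R? x ] ys) →
  (∀ {y} → Q y → #[ flip R? y ] xs ≤ d) →
  c * #[ P? ] xs ≤ d * #[ Q? ] ys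
double-counting {A = A} {B = B} {Q = Q} P? Q? R? xs ys {c} {d} R⇒Q c≤ ≤d = begin
  c * #[ P? ] xs
    ≤⟨ *-#-≤-sum P? (λ x → #[ R? x ] ys) c≤ xs ⟩
  sum (map (λ x → #[ R? x ] ys) xs)
    ≡⟨ cong sum (map-cong (λ x → #-as-sum (R? x) ys) xs) ⟩
  sum (map (λ x → sum (map (F x) ys)) xs)
    ≡⟨ sum-map-swap F xs ys ⟩
  sum (map (λ y → sum (map (flip F y) xs)) ys)
    ≡⟨ cong sum (map-cong (λ y → #-as-sum (flip R? y) xs) ys) ⟨
  sum (map (λ y → #[ flip R? y ] xs) ys)
    ≤⟨ sum-≤-*-# Q? (λ y → #[ flip R? y ] xs) ≤d none ys ⟩
  d * #[ Q? ] ys ∎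
  where
  open ≤-Reasoning
  F : A → B → ℕ
  F x y = if ⌊ R? x y ⌋ then 1 else 0
  none : ∀ {y} → ¬ Q y → #[ flip R? y ] xs ≡ 0
  none ¬Qy = #-none (flip R? _) (¬Qy ∘ R⇒Q) xs

-- Binomial coefficients and powers

nCk>0 : ∀ {n k} → k ≤ n → 0 < n C k
nCk>0 {n}     {zero}  _         = s≤s z≤n
nCk>0 {suc n} {suc k} (s≤s k≤n) =
  subst (0 <_) (nCk+nC[k+1]≡[n+1]C[k+1] n k) (≤-trans (nCk>0 k≤n) (m≤m+n _ _))

[1+n]Ck≤[1+n]*nCk : ∀ {n k} → k ≤ n → suc n C k ≤ suc n * (n C k)
[1+n]Ck≤[1+n]*nCk {n}     {zero}  _         = s≤s z≤n
[1+n]Ck≤[1+n]*nCk {suc n} {suc k} (s≤s k≤n) = begin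
  suc (suc n) C suc k
    ≡⟨ nCk+nC[k+1]≡[n+1]C[k+1] (suc n) k ⟨
  suc n C k + suc n C suc k
    ≡⟨ cong (suc n C k +_) (nCk+nC[k+1]≡[n+1]C[k+1] n k) ⟨
  suc n C k + (n C k + n C suc k)
    ≤⟨ +-monoˡ-≤ (n C k + n C suc k) ([1+n]Ck≤[1+n]*nCk k≤n) ⟩
  suc n * (n C k) + (n C k + n C suc k)
    ≡⟨ +-assoc (suc n * (n C k)) (n C k) (n C suc k) ⟨
  suc n * (n C k) + n C k + n C suc k
    ≡⟨ cong (_+ n C suc k) (+-comm (suc n * (n C k)) (n C k)) ⟩
  suc (suc n) * (n C k) + n C suc k
    ≤⟨ +-monoʳ-≤ (suc (suc n) * (n C k)) (m≤n*m (n C suc k) (suc (suc n))) ⟩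
  suc (suc n) * (n C k) + suc (suc n) * (n C suc k)
    ≡⟨ *-distribˡ-+ (suc (suc n)) (n C k) (n C suc k) ⟨
  suc (suc n) * (n C k + n C suc k)
    ≡⟨ cong (suc (suc n) *_) (nCk+nC[k+1]≡[n+1]C[k+1] n k) ⟩
  suc (suc n) * (suc n C suc k) ∎
  where open ≤-Reasoning

n≤nCk : ∀ {n k} → 0 < k → k < n → n ≤ n C k
n≤nCk {n}     {suc zero}    _ _               = ≤-reflexive (sym (nC1≡n n))
n≤nCk {suc n} {suc (suc k)} _ (s≤s k+1<n) = begin
  suc n                        ≡⟨ +-comm 1 n ⟩
  n + 1                        ≤⟨ +-mono-≤ (n≤nCk (s≤s z≤n) k+1<n) (nCk>0 k+1<n) ⟩
  n C suc k + n C suc (suc k)  ≡⟨ nCk+nC[k+1]≡[n+1]C[k+1] n (suc k) ⟩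
  suc n C suc (suc k)          ∎
  where open ≤-Reasoning

^-bernoulli : ∀ x y k → x ^ k * (x + suc k * y) ≤ (x + y) ^ suc k
^-bernoulli x y zero = ≤-reflexive (base x y)
  where
  base : ∀ x y → 1 * (x + 1 * y) ≡ (x + y) * 1
  base = solve-∀
^-bernoulli x y (suc k) = begin
  x ^ suc k * (x + suc (suc k) * y)              ≡⟨ unfold x (x ^ k) k y ⟩
  x * (x ^ k * (x + suc k * y)) + x ^ suc k * y ≤⟨ +-mono-≤ (*-monoʳ-≤ x (^-bernoulli x y k))
                                                             (*-monoˡ-≤ y (^-monoˡ-≤ (suc k) (m≤m+n x y))) ⟩
  x * (x + y) ^ suc k + (x + y) ^ suc k * y     ≡⟨ fold x y ((x + y) ^ suc k) ⟩
  (x + y) ^ suc (suc k)                         ∎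
  where
  open ≤-Reasoning
  unfold : ∀ x p k y → x * p * (x + (2 + k) * y) ≡ x * (p * (x + (1 + k) * y)) + x * p * y
  unfold = solve-∀
  fold : ∀ x y q → x * q + q * y ≡ (x + y) * q
  fold = solve-∀

[x+y]^r≤2x^r⇒r*y≤x : ∀ {x y r} → 0 < x → 0 < r → (x + y) ^ r ≤ 2 * x ^ r → r * y ≤ x
[x+y]^r≤2x^r⇒r*y≤x {x@(suc _)} {y} {suc k} _ _ bound =
  +-cancelˡ-≤ x _ _ (*-cancelˡ-≤ (x ^ k) {{>-nonZero (m^n>0 x k)}} (begin
    x ^ k * (x + suc k * y) ≤⟨ ^-bernoulli x y k ⟩
    (x + y) ^ suc k         ≤⟨ bound ⟩
    2 * x ^ suc k           ≡⟨ double x (x ^ k) ⟩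
    x ^ k * (x + x)         ∎))
  where
  open ≤-Reasoning
  double : ∀ x p → 2 * (x * p) ≡ p * (x + x)
  double = solve-∀

x^r≤2y^r⇒x^m≤2y^m : ∀ {x y m r} → 0 < y → y ≤ x → m ≤ r → x ^ r ≤ 2 * y ^ r → x ^ m ≤ 2 * y ^ m
x^r≤2y^r⇒x^m≤2y^m {x} {y@(suc _)} {m} {r} _ y≤x m≤r bound =
  *-cancelˡ-≤ (y ^ (r ∸ m)) {{>-nonZero (m^n>0 y (r ∸ m))}} (begin
    y ^ (r ∸ m) * x ^ m      ≤⟨ *-monoˡ-≤ (x ^ m) (^-monoˡ-≤ (r ∸ m) y≤x) ⟩
    x ^ (r ∸ m) * x ^ m      ≡⟨ ^-distribˡ-+-* x (r ∸ m) m ⟨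
    x ^ (r ∸ m + m)          ≡⟨ cong (x ^_) (m∸n+n≡m m≤r) ⟩
    x ^ r                    ≤⟨ bound ⟩
    2 * y ^ r                ≡⟨ cong (λ e → 2 * y ^ e) (m∸n+n≡m m≤r) ⟨
    2 * y ^ (r ∸ m + m)      ≡⟨ cong (2 *_) (^-distribˡ-+-* y (r ∸ m) m) ⟩
    2 * (y ^ (r ∸ m) * y ^ m) ≡⟨ x∙yz≈y∙xz 2 (y ^ (r ∸ m)) (y ^ m) ⟩
    y ^ (r ∸ m) * (2 * y ^ m) ∎)
  where open ≤-Reasoning

c*y≤x⇒[c∸1]*x≤c*[x∸y] : ∀ c x y → c * y ≤ x → (c ∸ 1) * x ≤ c * (x ∸ y)
c*y≤x⇒[c∸1]*x≤c*[x∸y] c x y c*y≤x = begin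
  (c ∸ 1) * x     ≡⟨ *-distribʳ-∸ x c 1 ⟩
  c * x ∸ 1 * x   ≡⟨ cong (c * x ∸_) (*-identityˡ x) ⟩
  c * x ∸ x       ≤⟨ ∸-monoʳ-≤ (c * x) c*y≤x ⟩
  c * x ∸ c * y   ≡⟨ *-distribˡ-∸ c x y ⟨
  c * (x ∸ y)     ∎
  where open ≤-Reasoning

-- Subsets of Fin n

∣p∣>0⇒nonempty : ∀ {p : Subset n} → 0 < ∣ p ∣ → Nonempty p
∣p∣>0⇒nonempty {n} {p} ∣p∣>0 with nonempty? p
... | yes ne = ne
... | no  ¬ne = contradiction (trans (cong ∣_∣ (Empty-unique ¬ne)) (∣⊥∣≡0 n)) (>⇒≢ ∣p∣>0)

nonempty⇒∣p∣>0 : ∀ {p : Subset n} → Nonempty p → 0 < ∣ p ∣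
nonempty⇒∣p∣>0 {p = p} (x , x∈p) = ≤-trans (≤-reflexive (sym (∣⁅x⁆∣≡1 x))) (p⊆q⇒∣p∣≤∣q∣ ⁅x⁆⊆p)
  where
  ⁅x⁆⊆p : ⁅ x ⁆ ⊆ p
  ⁅x⁆⊆p y∈⁅x⁆ = subst (_∈ p) (sym (x∈⁅y⁆⇒x≡y x y∈⁅x⁆)) x∈p

∣p∪⁅x⁆∣≡1+∣p∣ : ∀ {p : Subset n} {x} → x ∉ p → ∣ p ∪ ⁅ x ⁆ ∣ ≡ suc ∣ p ∣
∣p∪⁅x⁆∣≡1+∣p∣ {p = inside  ∷ p} {fzero}  x∉p = contradiction here x∉p
∣p∪⁅x⁆∣≡1+∣p∣ {p = outside ∷ p} {fzero}  x∉p = cong (suc ∘ ∣_∣) (∪-identityʳ p)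
∣p∪⁅x⁆∣≡1+∣p∣ {p = inside  ∷ p} {fsuc x} x∉p = cong suc (∣p∪⁅x⁆∣≡1+∣p∣ (x∉p ∘ there))
∣p∪⁅x⁆∣≡1+∣p∣ {p = outside ∷ p} {fsuc x} x∉p = ∣p∪⁅x⁆∣≡1+∣p∣ (x∉p ∘ there)

p⊆r∧x∈r⇒p∪⁅x⁆⊆r : ∀ {p r : Subset n} {x} → p ⊆ r → x ∈ r → p ∪ ⁅ x ⁆ ⊆ r
p⊆r∧x∈r⇒p∪⁅x⁆⊆r {p = p} {x = x} p⊆r x∈r y∈ with x∈p∪q⁻ p ⁅ x ⁆ y∈
... | inj₁ y∈p   = p⊆r y∈p
... | inj₂ y∈⁅x⁆ = subst (_∈ _) (sym (x∈⁅y⁆⇒x≡y x y∈⁅x⁆)) x∈r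

x∈p⇒1+∣p-x∣≡∣p∣ : ∀ {p : Subset n} {x} → x ∈ p → suc ∣ p - x ∣ ≡ ∣ p ∣
x∈p⇒1+∣p-x∣≡∣p∣ {p = inside ∷ p} {fzero} here = cong (suc ∘ ∣_∣) (p─⊥≡p p)
x∈p⇒1+∣p-x∣≡∣p∣ {p = inside  ∷ p} {fsuc x} (there x∈p) = cong suc (x∈p⇒1+∣p-x∣≡∣p∣ x∈p)
x∈p⇒1+∣p-x∣≡∣p∣ {p = outside ∷ p} {fsuc x} (there x∈p) = x∈p⇒1+∣p-x∣≡∣p∣ x∈p

p─q⊆∁q : ∀ (p q : Subset n) → p ─ q ⊆ ∁ q
p─q⊆∁q (_ ∷ p) (outside ∷ q) here        = here
p─q⊆∁q (_ ∷ p) (inside  ∷ q) (there x∈)  = there (p─q⊆∁q p q x∈)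
p─q⊆∁q (_ ∷ p) (outside ∷ q) (there x∈)  = there (p─q⊆∁q p q x∈)

p⊆∁q⇒p─q≡p : ∀ {p q : Subset n} → p ⊆ ∁ q → p ─ q ≡ p
p⊆∁q⇒p─q≡p {p = []}          {[]}          _   = refl
p⊆∁q⇒p─q≡p {p = x ∷ p}       {outside ∷ q} p⊆ = cong (x ∷_) (p⊆∁q⇒p─q≡p (drop-∷-⊆ p⊆))
p⊆∁q⇒p─q≡p {p = outside ∷ p} {inside ∷ q}  p⊆ = cong (outside ∷_) (p⊆∁q⇒p─q≡p (drop-∷-⊆ p⊆))
p⊆∁q⇒p─q≡p {p = inside ∷ p}  {inside ∷ q}  p⊆ with () ← p⊆ here

p⊈q⇒p─q-nonempty : ∀ {p q : Subset n} → ¬ p ⊆ q → Nonempty (p ─ q)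
p⊈q⇒p─q-nonempty {p = p} {q} p⊈q with nonempty? (p ─ q)
... | yes ne    = ne
... | no  empty = ⊥-elim (p⊈q p⊆q)
  where
  p⊆q : p ⊆ q
  p⊆q {x} x∈p = decidable-stable (x ∈? q) (λ x∉q → empty (x , x∈p∧x∉q⇒x∈p─q x∈p x∉q))

∈-allSubsets : ∀ (p : Subset n) → p ∈ₗ allSubsets n
∈-allSubsets []            = here refl
∈-allSubsets (outside ∷ p) = ∈-++⁺ˡ (∈-map⁺ (outside ∷_) (∈-allSubsets p))
∈-allSubsets (inside  ∷ p) = ∈-++⁺ʳ _ (∈-map⁺ (inside ∷_) (∈-allSubsets p))

#-allSubsets-suc : {P : Pred (Subset (suc n)) p} (P? : Decidable P) →
  #[ P? ] (allSubsets (suc n)) ≡ #[ P? ∘ (outside ∷_) ] (allSubsets n) + #[ P? ∘ (inside ∷_) ] (allSubsets n)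
#-allSubsets-suc {n} P? = begin
  #[ P? ] (map (outside ∷_) (allSubsets n) ++ map (inside ∷_) (allSubsets n))
    ≡⟨ #-++ P? (map (outside ∷_) (allSubsets n)) _ ⟩
  #[ P? ] (map (outside ∷_) (allSubsets n)) + #[ P? ] (map (inside ∷_) (allSubsets n))
    ≡⟨ cong₂ _+_ (#-map P? (outside ∷_) (allSubsets n)) (#-map P? (inside ∷_) (allSubsets n)) ⟩
  #[ P? ∘ (outside ∷_) ] (allSubsets n) + #[ P? ∘ (inside ∷_) ] (allSubsets n) ∎
  where open ≡-Reasoning

Between : Subset n → Subset n → ℕ → Pred (Subset n) 0ℓ
Between K T k J = K ⊆ J × J ⊆ T × ∣ J ∣ ≡ ∣ K ∣ + k

between? : ∀ (K T : Subset n) k → Decidable (Between K T k)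
between? K T k J = K ⊆? J ×-dec J ⊆? T ×-dec ∣ J ∣ ≟ ∣ K ∣ + k

#-between : ∀ {K T : Subset n} k → K ⊆ T → #[ between? K T k ] (allSubsets n) ≡ (∣ T ∣ ∸ ∣ K ∣) C k
#-between {K = []} {[]} zero    _ = refl
#-between {K = []} {[]} (suc k) _ = refl
#-between {suc n} {outside ∷ K} {outside ∷ T} k K⊆T = begin
  #[ P? ] (allSubsets (suc n))
    ≡⟨ #-allSubsets-suc P? ⟩
  #[ P? ∘ (outside ∷_) ] (allSubsets n) + #[ P? ∘ (inside ∷_) ] (allSubsets n)
    ≡⟨ cong₂ _+_ (sym (#-cong (between? K T k) _ (out⊆-⇔ ×-⇔ out⊆-⇔ ×-⇔ ⇔-refl) (allSubsets n)))
                 (#-none (P? ∘ (inside ∷_)) (λ (_ , J⊆T , _) → case J⊆T here of λ ()) (allSubsets n)) ⟩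
  #[ between? K T k ] (allSubsets n) + 0
    ≡⟨ +-identityʳ _ ⟩
  #[ between? K T k ] (allSubsets n)
    ≡⟨ #-between k (drop-∷-⊆ K⊆T) ⟩
  (∣ T ∣ ∸ ∣ K ∣) C k ∎
  where
  open ≡-Reasoning
  P? : Decidable (Between (outside ∷ K) (outside ∷ T) k)
  P? = between? (outside ∷ K) (outside ∷ T) k
#-between {suc n} {inside ∷ K} {inside ∷ T} k K⊆T = begin
  #[ P? ] (allSubsets (suc n))
    ≡⟨ #-allSubsets-suc P? ⟩
  #[ P? ∘ (outside ∷_) ] (allSubsets n) + #[ P? ∘ (inside ∷_) ] (allSubsets n)
    ≡⟨ cong₂ _+_ (#-none (P? ∘ (outside ∷_)) (λ (K⊆J , _) → case K⊆J here of λ ()) (allSubsets n))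
                 (sym (#-cong (between? K T k) _ (in⊆in-⇔ ×-⇔ in⊆in-⇔ ×-⇔ mk⇔ (cong suc) suc-injective) (allSubsets n))) ⟩
  0 + #[ between? K T k ] (allSubsets n)
    ≡⟨ #-between k (drop-∷-⊆ K⊆T) ⟩
  (∣ T ∣ ∸ ∣ K ∣) C k ∎
  where
  open ≡-Reasoning
  P? : Decidable (Between (inside ∷ K) (inside ∷ T) k)
  P? = between? (inside ∷ K) (inside ∷ T) k
#-between {suc n} {outside ∷ K} {inside ∷ T} zero K⊆T = begin
  #[ P? ] (allSubsets (suc n))
    ≡⟨ #-allSubsets-suc P? ⟩
  #[ P? ∘ (outside ∷_) ] (allSubsets n) + #[ P? ∘ (inside ∷_) ] (allSubsets n)
    ≡⟨ cong₂ _+_ (sym (#-cong (between? K T 0) _ (out⊆-⇔ ×-⇔ out⊆-⇔ ×-⇔ ⇔-refl) (allSubsets n)))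
                 (#-none (P? ∘ (inside ∷_)) too-small (allSubsets n)) ⟩
  #[ between? K T 0 ] (allSubsets n) + 0
    ≡⟨ +-identityʳ _ ⟩
  #[ between? K T 0 ] (allSubsets n)
    ≡⟨ #-between 0 (drop-∷-⊆ K⊆T) ⟩
  1 ∎
  where
  open ≡-Reasoning
  P? : Decidable (Between (outside ∷ K) (inside ∷ T) 0)
  P? = between? (outside ∷ K) (inside ∷ T) 0
  too-small : ∀ {J} → ¬ Between (outside ∷ K) (inside ∷ T) 0 (inside ∷ J)
  too-small (K⊆J , _ , ∣J∣+1≡∣K∣) = <-irrefl refl
    (≤-trans (≤-reflexive (trans ∣J∣+1≡∣K∣ (+-identityʳ _))) (p⊆q⇒∣p∣≤∣q∣ (drop-∷-⊆ K⊆J)))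
#-between {suc n} {outside ∷ K} {inside ∷ T} (suc k) K⊆T = begin
  #[ P? ] (allSubsets (suc n))
    ≡⟨ #-allSubsets-suc P? ⟩
  #[ P? ∘ (outside ∷_) ] (allSubsets n) + #[ P? ∘ (inside ∷_) ] (allSubsets n)
    ≡⟨ cong₂ _+_ (#-cong (between? K T (suc k)) _ (out⊆-⇔ ×-⇔ out⊆-⇔ ×-⇔ ⇔-refl) (allSubsets n))
                 (#-cong (between? K T k) _ (λ {J} → out⊆-⇔ ×-⇔ in⊆in-⇔ ×-⇔ grow {J}) (allSubsets n)) ⟨
  #[ between? K T (suc k) ] (allSubsets n) + #[ between? K T k ] (allSubsets n)
    ≡⟨ cong₂ _+_ (#-between (suc k) K⊆T′) (#-between k K⊆T′) ⟩
  (∣ T ∣ ∸ ∣ K ∣) C suc k + (∣ T ∣ ∸ ∣ K ∣) C k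
    ≡⟨ +-comm ((∣ T ∣ ∸ ∣ K ∣) C suc k) _ ⟩
  (∣ T ∣ ∸ ∣ K ∣) C k + (∣ T ∣ ∸ ∣ K ∣) C suc k
    ≡⟨ nCk+nC[k+1]≡[n+1]C[k+1] (∣ T ∣ ∸ ∣ K ∣) k ⟩
  suc (∣ T ∣ ∸ ∣ K ∣) C suc k
    ≡⟨ cong (_C suc k) (+-∸-assoc 1 (p⊆q⇒∣p∣≤∣q∣ K⊆T′)) ⟨
  (suc ∣ T ∣ ∸ ∣ K ∣) C suc k ∎
  where
  open ≡-Reasoning
  P? : Decidable (Between (outside ∷ K) (inside ∷ T) (suc k))
  P? = between? (outside ∷ K) (inside ∷ T) (suc k)
  K⊆T′ : K ⊆ T
  K⊆T′ = drop-∷-⊆ K⊆T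
  grow : ∀ {J} → (∣ J ∣ ≡ ∣ K ∣ + k) ⇔ (suc ∣ J ∣ ≡ ∣ K ∣ + suc k)
  grow = mk⇔ (λ e → trans (cong suc e) (sym (+-suc _ k))) (λ e → suc-injective (trans e (+-suc _ k)))
#-between {K = inside ∷ K} {outside ∷ T} k K⊆T with () ← K⊆T here

elements : Subset n → List (Fin n)
elements []            = []
elements (inside  ∷ p) = fzero ∷ map fsuc (elements p)
elements (outside ∷ p) = map fsuc (elements p)

length-elements : ∀ (p : Subset n) → length (elements p) ≡ ∣ p ∣
length-elements []            = refl
length-elements (inside  ∷ p) = cong suc (trans (length-map fsuc (elements p)) (length-elements p))
length-elements (outside ∷ p) = trans (length-map fsuc (elements p)) (length-elements p)

∈-elements⁺ : ∀ {p : Subset n} {x} → x ∈ p → x ∈ₗ elements p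
∈-elements⁺ {p = inside  ∷ p} here        = here refl
∈-elements⁺ {p = inside  ∷ p} (there x∈p) = there (∈-map⁺ fsuc (∈-elements⁺ x∈p))
∈-elements⁺ {p = outside ∷ p} (there x∈p) = ∈-map⁺ fsuc (∈-elements⁺ x∈p)

∈-elements⁻ : ∀ {p : Subset n} {x} → x ∈ₗ elements p → x ∈ p
∈-elements⁻ {p = inside  ∷ p} (here refl) = here
∈-elements⁻ {p = inside  ∷ p} (there x∈)  with ∈-map⁻ fsuc x∈
... | _ , y∈ , refl = there (∈-elements⁻ y∈)
∈-elements⁻ {p = outside ∷ p} x∈          with ∈-map⁻ fsuc x∈
... | _ , y∈ , refl = there (∈-elements⁻ y∈)

Avoids : List (Fin n) → Pred (Subset n) 0ℓ
Avoids vs X = All (_∉ X) vs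

avoids? : ∀ (vs : List (Fin n)) → Decidable (Avoids vs)
avoids? vs X = all? (λ v → ¬? (v ∈? X)) vs

avoids-elements⇒⊆∁ : ∀ {p X : Subset n} → Avoids (elements p) X → X ⊆ ∁ p
avoids-elements⇒⊆∁ av x∈X = x∉p⇒x∈∁p (λ x∈p → All.lookup av (∈-elements⁺ x∈p) x∈X)

⊆∁⇒avoids-elements : ∀ {p X : Subset n} → X ⊆ ∁ p → Avoids (elements p) X
⊆∁⇒avoids-elements X⊆∁p = All.tabulate (λ v∈ v∈X → x∈∁p⇒x∉p (X⊆∁p v∈X) (∈-elements⁻ v∈))

-- Families of subsets and G ∖ S

module _ (f : A → Bool) where

  anyB-witness : ∀ xs → anyB f xs ≡ true → ∃ λ x → f x ≡ true
  anyB-witness (x ∷ xs) any with f x in fx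
  ... | true  = x , fx
  ... | false = anyB-witness xs any

  anyB-intro : ∀ {x xs} → x ∈ₗ xs → f x ≡ true → anyB f xs ≡ true
  anyB-intro {xs = y ∷ xs} x∈ fx with f y in fy
  ... | true  = refl
  anyB-intro {xs = y ∷ xs} (here refl) fx | false = contradiction (trans (sym fy) fx) λ ()
  anyB-intro {xs = y ∷ xs} (there x∈)  fx | false = anyB-intro x∈ fx

Extension : Family n → ℕ → List (Fin n) → Subset n → Pred (Subset n) 0ℓ
Extension F m vs K X = F X ≡ true × ∣ X ∣ ≡ m × Avoids vs X × K ⊆ X

extension? : ∀ (F : Family n) m vs K → Decidable (Extension F m vs K)
extension? F m vs K X = F X Bool.≟ true ×-dec ∣ X ∣ ≟ m ×-dec avoids? vs X ×-dec K ⊆? X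

deg≡#extension : ∀ t (F : Family n) K → deg t F K ≡ #[ extension? F t [] K ] (allSubsets n)
deg≡#extension {n} t F K = countB-cong same (allSubsets n)
  where
  same : ∀ X → (F X ∧ ⌊ ∣ X ∣ ≟ t ⌋ ∧ ⌊ K ⊆? X ⌋) ≡ ⌊ extension? F t [] K X ⌋
  same X with F X | ∣ X ∣ ≟ t | K ⊆? X
  ... | true  | yes _ | yes _ = refl
  ... | true  | yes _ | no  _ = refl
  ... | true  | no  _ | _     = refl
  ... | false | _     | _     = refl

deg-mono : ∀ {t} {F F′ : Family n} → (∀ {X} → F X ≡ true → F′ X ≡ true) → ∀ K → deg t F K ≤ deg t F′ K
deg-mono {n} {t} {F} {F′} F⊆F′ K = begin
  deg t F K
    ≡⟨ deg≡#extension t F K ⟩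
  #[ extension? F t [] K ] (allSubsets n)
    ≤⟨ #-mono _ _ (λ (FX , rest) → F⊆F′ FX , rest) (allSubsets n) ⟩
  #[ extension? F′ t [] K ] (allSubsets n)
    ≡⟨ deg≡#extension t F′ K ⟨
  deg t F′ K ∎
  where open ≤-Reasoning

module _ {t} {G : Family n} (G-complex : IsComplex t G) where

  complex-closed : ∀ {K L} → G K ≡ true → L ⊆ K → 0 < ∣ L ∣ → G L ≡ true
  complex-closed GK L⊆K 0<∣L∣ = proj₂ (proj₂ (G-complex _ GK)) _ (∣p∣>0⇒nonempty 0<∣L∣) L⊆K

  module _ (S : Subset n) where

    ∖-elim : ∀ {K} → (G ∖ S) K ≡ true → ∃ λ K′ → G K′ ≡ true × ¬ K′ ⊆ S × K′ ─ S ≡ K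
    ∖-elim {K} K∈ with anyB-witness _ (allSubsets n) K∈
    ... | K′ , holds with G K′ in GK′ | K′ ⊆? S | Vec.≡-dec Bool._≟_ (K′ ─ S) K
    ...   | true | no K′⊈S | yes K′─S≡K = K′ , GK′ , K′⊈S , K′─S≡K
    ...   | true | no _    | no  _      = case holds of λ ()
    ...   | true | yes _   | _          = case holds of λ ()
    ...   | false | _      | _          = case holds of λ ()

    ∖-intro─ : ∀ {K} → G K ≡ true → ¬ K ⊆ S → (G ∖ S) (K ─ S) ≡ true
    ∖-intro─ {K} GK K⊈S = anyB-intro _ (∈-allSubsets K) holds
      where
      holds : (G K ∧ not ⌊ K ⊆? S ⌋ ∧ ⌊ Vec.≡-dec Bool._≟_ (K ─ S) (K ─ S) ⌋) ≡ true
      holds rewrite GK with K ⊆? S | Vec.≡-dec Bool._≟_ (K ─ S) (K ─ S)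
      ... | yes K⊆S | _      = ⊥-elim (K⊈S K⊆S)
      ... | no  _   | yes _  = refl
      ... | no  _   | no K≢K = contradiction refl K≢K

    ∖-member : ∀ {K} → (G ∖ S) K ≡ true → G K ≡ true × K ⊆ ∁ S
    ∖-member K∈ with ∖-elim K∈
    ... | K′ , GK′ , K′⊈S , refl =
      complex-closed GK′ (p─q⊆p K′ S) (nonempty⇒∣p∣>0 (p⊈q⇒p─q-nonempty K′⊈S)) , p─q⊆∁q K′ S

    ∖-intro : ∀ {K} → G K ≡ true → 0 < ∣ K ∣ → K ⊆ ∁ S → (G ∖ S) K ≡ true
    ∖-intro {K} GK 0<∣K∣ K⊆∁S = subst (λ L → (G ∖ S) L ≡ true) (p⊆∁q⇒p─q≡p K⊆∁S) (∖-intro─ GK K⊈S)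
      where
      K⊈S : ¬ K ⊆ S
      K⊈S K⊆S = let (x , x∈K) = ∣p∣>0⇒nonempty 0<∣K∣ in x∈∁p⇒x∉p (K⊆∁S x∈K) (K⊆S x∈K)

    ∖-isComplex : IsComplex t (G ∖ S)
    ∖-isComplex K K∈ with ∖-elim K∈
    ... | K′ , GK′ , K′⊈S , refl =
      p⊈q⇒p─q-nonempty K′⊈S , ≤-trans (∣p─q∣≤∣p∣ K′ S) (proj₁ (proj₂ (G-complex K′ GK′))) , closed
      where
      closed : ∀ L → Nonempty L → L ⊆ K′ ─ S → (G ∖ S) L ≡ true
      closed L L≠∅ L⊆ = ∖-intro (complex-closed GK′ (⊆-trans L⊆ (p─q⊆p K′ S)) (nonempty⇒∣p∣>0 L≠∅))
                                (nonempty⇒∣p∣>0 L≠∅) (⊆-trans L⊆ (p─q⊆∁q K′ S))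

    deg-∖≤deg : ∀ K → deg t (G ∖ S) K ≤ deg t G K
    deg-∖≤deg = deg-mono (proj₁ ∘ ∖-member)

    #extension[elements]≤deg-∖ : 0 < t → ∀ K → #[ extension? G t (elements S) K ] (allSubsets n) ≤ deg t (G ∖ S) K
    #extension[elements]≤deg-∖ 0<t K = begin
      #[ extension? G t (elements S) K ] (allSubsets n)  ≤⟨ #-mono _ _ in-G∖S (allSubsets n) ⟩
      #[ extension? (G ∖ S) t [] K ] (allSubsets n)      ≡⟨ deg≡#extension t (G ∖ S) K ⟨
      deg t (G ∖ S) K                                    ∎
      where
      open ≤-Reasoning
      in-G∖S : ∀ {T} → Extension G t (elements S) K T → Extension (G ∖ S) t [] K T
      in-G∖S (GT , ∣T∣≡t , avT , K⊆T) =
        ∖-intro GT (subst (0 <_) (sym ∣T∣≡t) 0<t) (avoids-elements⇒⊆∁ avT) , ∣T∣≡t , [] , K⊆T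

-- Deleting vertices one at a time

module Removal {n t s ℓ} {G : Family n} (G-complex : IsComplex t G) (0<s : 0 < s) (s<t : s < t)
  (deg≤ℓ : ∀ K → G K ≡ true → ∣ K ∣ ≡ suc s → deg t G K ≤ ℓ) where

  N : List (Fin n) → Subset n → ℕ
  N vs K = #[ extension? G t vs K ] (allSubsets n)

  Nᵥ : Fin n → List (Fin n) → Subset n → ℕ
  Nᵥ v vs K = #[ extension? G t vs K ∩? (v ∈?_) ] (allSubsets n)

  ∣L∣≡1+s⇒deg≤ℓ : ∀ L → ∣ L ∣ ≡ suc s → deg t G L ≤ ℓ
  ∣L∣≡1+s⇒deg≤ℓ L ∣L∣≡1+s with 0 <? deg t G L
  ... | no  deg≯0 = ≤-trans (≮⇒≥ deg≯0) z≤n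
  ... | yes 0<deg with #-witness (extension? G t [] L) (allSubsets n) (subst (0 <_) (deg≡#extension t G L) 0<deg)
  ...   | T , GT , _ , _ , L⊆T =
    deg≤ℓ L (complex-closed G-complex GT L⊆T (subst (0 <_) (sym ∣L∣≡1+s) (s≤s z≤n))) ∣L∣≡1+s

  #-through-vertex≤ℓ : ∀ {J v} {P : Pred (Subset n) 0ℓ} (P? : Decidable P) → ∣ J ∣ ≡ s → v ∉ J →
    (∀ {T} → P T → Extension G t [] J T × v ∈ T) → #[ P? ] (allSubsets n) ≤ ℓ
  #-through-vertex≤ℓ {J} {v} {P} P? ∣J∣≡s v∉J P⇒ = begin
    #[ P? ] (allSubsets n)
      ≤⟨ #-mono P? (extension? G t [] (J ∪ ⁅ v ⁆)) extends (allSubsets n) ⟩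
    #[ extension? G t [] (J ∪ ⁅ v ⁆) ] (allSubsets n)
      ≡⟨ deg≡#extension t G (J ∪ ⁅ v ⁆) ⟨
    deg t G (J ∪ ⁅ v ⁆)
      ≤⟨ ∣L∣≡1+s⇒deg≤ℓ (J ∪ ⁅ v ⁆) (trans (∣p∪⁅x⁆∣≡1+∣p∣ v∉J) (cong suc ∣J∣≡s)) ⟩
    ℓ ∎
    where
    open ≤-Reasoning
    extends : ∀ {T} → P T → Extension G t [] (J ∪ ⁅ v ⁆) T
    extends PT with P⇒ PT
    ... | (GT , ∣T∣≡t , _ , J⊆T) , v∈T = GT , ∣T∣≡t , [] , p⊆r∧x∈r⇒p∪⁅x⁆⊆r J⊆T v∈T

  N-split : ∀ v vs K → N vs K ≡ N (v ∷ vs) K + Nᵥ v vs K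
  N-split v vs K = begin
    N vs K
      ≡⟨ #-split (extension? G t vs K) (v ∈?_) (allSubsets n) ⟩
    Nᵥ v vs K + #[ extension? G t vs K ∩? ∁? (v ∈?_) ] (allSubsets n)
      ≡⟨ +-comm (Nᵥ v vs K) _ ⟩
    #[ extension? G t vs K ∩? ∁? (v ∈?_) ] (allSubsets n) + Nᵥ v vs K
      ≡⟨ cong (_+ Nᵥ v vs K) (#-cong _ (extension? G t (v ∷ vs) K) avoid-v (allSubsets n)) ⟩
    N (v ∷ vs) K + Nᵥ v vs K ∎
    where
    open ≡-Reasoning
    avoid-v : ∀ {T} → (Extension G t vs K T × v ∉ T) ⇔ Extension G t (v ∷ vs) K T
    avoid-v = mk⇔ (λ ((GT , ∣T∣ , av , K⊆T) , v∉T) → GT , ∣T∣ , v∉T ∷ av , K⊆T)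
                  (λ { (GT , ∣T∣ , v∉T ∷ av , K⊆T) → (GT , ∣T∣ , av , K⊆T) , v∉T })

  deg≤N+∣vs∣*ℓ : ∀ vs {J} → G J ≡ true → ∣ J ∣ ≡ s → Avoids vs J → deg t G J ≤ N vs J + length vs * ℓ
  deg≤N+∣vs∣*ℓ [] {J} _ _ _ = ≤-reflexive (trans (deg≡#extension t G J) (sym (+-identityʳ _)))
  deg≤N+∣vs∣*ℓ (v ∷ vs) {J} GJ ∣J∣≡s (v∉J ∷ avJ) = begin
    deg t G J
      ≤⟨ deg≤N+∣vs∣*ℓ vs GJ ∣J∣≡s avJ ⟩
    N vs J + length vs * ℓ
      ≡⟨ cong (_+ length vs * ℓ) (N-split v vs J) ⟩
    N (v ∷ vs) J + Nᵥ v vs J + length vs * ℓ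
      ≤⟨ +-monoˡ-≤ (length vs * ℓ) (+-monoʳ-≤ (N (v ∷ vs) J) Nᵥ≤ℓ) ⟩
    N (v ∷ vs) J + ℓ + length vs * ℓ
      ≡⟨ +-assoc (N (v ∷ vs) J) ℓ _ ⟩
    N (v ∷ vs) J + length (v ∷ vs) * ℓ ∎
    where
    open ≤-Reasoning
    Nᵥ≤ℓ : Nᵥ v vs J ≤ ℓ
    Nᵥ≤ℓ = #-through-vertex≤ℓ (extension? G t vs J ∩? (v ∈?_)) ∣J∣≡s v∉J
             (λ ((GT , ∣T∣≡t , _ , J⊆T) , v∈T) → (GT , ∣T∣≡t , [] , J⊆T) , v∈T)

  W*#extension≤C*N : ∀ {vs K W} → ∣ K ∣ ≤ s → (∀ {J} → Extension G s vs K J → W ≤ N vs J) →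
    W * #[ extension? G s vs K ] (allSubsets n) ≤ ((t ∸ ∣ K ∣) C (s ∸ ∣ K ∣)) * N vs K
  W*#extension≤C*N {vs} {K} {W} ∣K∣≤s W≤N =
    double-counting (extension? G s vs K) (extension? G t vs K) R? (allSubsets n) (allSubsets n)
      (λ (_ , _ , T-ext) → T-ext) many few
    where
    R : Subset n → Subset n → Set
    R J T = Extension G s vs K J × J ⊆ T × Extension G t vs K T
    R? : ∀ J T → Dec (R J T)
    R? J T = extension? G s vs K J ×-dec J ⊆? T ×-dec extension? G t vs K T
    many : ∀ {J} → Extension G s vs K J → W ≤ #[ R? J ] (allSubsets n)
    many J-ext@(_ , _ , _ , K⊆J) = ≤-trans (W≤N J-ext) (#-mono (extension? G t vs _) (R? _)
      (λ T-ext@(GT , ∣T∣≡t , avT , J⊆T) → J-ext , J⊆T , GT , ∣T∣≡t , avT , ⊆-trans K⊆J J⊆T) (allSubsets n))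
    few : ∀ {T} → Extension G t vs K T → #[ (λ J → R? J T) ] (allSubsets n) ≤ (t ∸ ∣ K ∣) C (s ∸ ∣ K ∣)
    few {T} (_ , ∣T∣≡t , _ , K⊆T) = begin
      #[ (λ J → R? J T) ] (allSubsets n)
        ≤⟨ #-mono _ (between? K T (s ∸ ∣ K ∣)) between (allSubsets n) ⟩
      #[ between? K T (s ∸ ∣ K ∣) ] (allSubsets n)
        ≡⟨ #-between (s ∸ ∣ K ∣) K⊆T ⟩
      (∣ T ∣ ∸ ∣ K ∣) C (s ∸ ∣ K ∣)
        ≡⟨ cong (λ m → (m ∸ ∣ K ∣) C (s ∸ ∣ K ∣)) ∣T∣≡t ⟩
      (t ∸ ∣ K ∣) C (s ∸ ∣ K ∣) ∎
      where
      open ≤-Reasoning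
      between : ∀ {J} → R J T → Between K T (s ∸ ∣ K ∣) J
      between ((_ , ∣J∣≡s , _ , K⊆J) , J⊆T , _) = K⊆J , J⊆T , trans ∣J∣≡s (sym (m+[n∸m]≡n ∣K∣≤s))

  C*Nᵥ≤ℓ*#extension : ∀ {v vs K} → ∣ K ∣ ≤ s → v ∉ K →
    ((t ∸ suc ∣ K ∣) C (s ∸ ∣ K ∣)) * Nᵥ v vs K ≤ ℓ * #[ extension? G s (v ∷ vs) K ] (allSubsets n)
  C*Nᵥ≤ℓ*#extension {v} {vs} {K} ∣K∣≤s v∉K =
    double-counting (extension? G t vs K ∩? (v ∈?_)) (extension? G s (v ∷ vs) K) R? (allSubsets n) (allSubsets n)
      (λ (_ , _ , J-ext) → J-ext) many few
    where
    R : Subset n → Subset n → Set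
    R T J = (Extension G t vs K T × v ∈ T) × J ⊆ T × Extension G s (v ∷ vs) K J
    R? : ∀ T J → Dec (R T J)
    R? T J = (extension? G t vs K ∩? (v ∈?_)) T ×-dec J ⊆? T ×-dec extension? G s (v ∷ vs) K J
    many : ∀ {T} → Extension G t vs K T × v ∈ T → (t ∸ suc ∣ K ∣) C (s ∸ ∣ K ∣) ≤ #[ R? T ] (allSubsets n)
    many {T} T∋v@((GT , ∣T∣≡t , avT , K⊆T) , v∈T) = begin
      (t ∸ suc ∣ K ∣) C (s ∸ ∣ K ∣)
        ≡⟨ cong (λ m → (m ∸ suc ∣ K ∣) C (s ∸ ∣ K ∣)) t≡1+∣T-v∣ ⟩
      (∣ T - v ∣ ∸ ∣ K ∣) C (s ∸ ∣ K ∣)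
        ≡⟨ #-between (s ∸ ∣ K ∣) K⊆T-v ⟨
      #[ between? K (T - v) (s ∸ ∣ K ∣) ] (allSubsets n)
        ≤⟨ #-mono _ (R? T) related (allSubsets n) ⟩
      #[ R? T ] (allSubsets n) ∎
      where
      open ≤-Reasoning
      t≡1+∣T-v∣ : t ≡ suc ∣ T - v ∣
      t≡1+∣T-v∣ = trans (sym ∣T∣≡t) (sym (x∈p⇒1+∣p-x∣≡∣p∣ v∈T))
      K⊆T-v : K ⊆ T - v
      K⊆T-v x∈K = x∈p∧x≢y⇒x∈p-y (K⊆T x∈K) (λ { refl → v∉K x∈K })
      related : ∀ {J} → Between K (T - v) (s ∸ ∣ K ∣) J → R T J
      related {J} (K⊆J , J⊆T-v , ∣J∣≡) = T∋v , J⊆T , GJ , ∣J∣≡s , v∉J ∷ All.map (_∘ J⊆T) avT , K⊆J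
        where
        J⊆T : J ⊆ T
        J⊆T = ⊆-trans J⊆T-v (p─q⊆p T ⁅ v ⁆)
        ∣J∣≡s : ∣ J ∣ ≡ s
        ∣J∣≡s = trans ∣J∣≡ (m+[n∸m]≡n ∣K∣≤s)
        GJ : G J ≡ true
        GJ = complex-closed G-complex GT J⊆T (subst (0 <_) (sym ∣J∣≡s) 0<s)
        v∉J : v ∉ J
        v∉J v∈J = x∈∁p⇒x∉p (p─q⊆∁q T ⁅ v ⁆ (J⊆T-v v∈J)) (x∈⁅x⁆ v)
    few : ∀ {J} → Extension G s (v ∷ vs) K J → #[ (λ T → R? T J) ] (allSubsets n) ≤ ℓ
    few (_ , ∣J∣≡s , v∉J ∷ _ , _) = #-through-vertex≤ℓ _ ∣J∣≡s v∉J
      (λ (((GT , ∣T∣≡t , _) , v∈T) , J⊆T , _) → (GT , ∣T∣≡t , [] , J⊆T) , v∈T)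

  W*Nᵥ≤[t∸∣K∣]*ℓ*N : ∀ {v vs K W} → ∣ K ∣ ≤ s → v ∉ K → (∀ {J} → Extension G s vs K J → W ≤ N vs J) →
    W * Nᵥ v vs K ≤ (t ∸ ∣ K ∣) * ℓ * N vs K
  W*Nᵥ≤[t∸∣K∣]*ℓ*N {v} {vs} {K} {W} ∣K∣≤s v∉K W≤N = *-cancelˡ-≤ c {{>-nonZero 0<c}} (begin
    c * (W * Nᵥ v vs K)
      ≡⟨ x∙yz≈y∙xz c W _ ⟩
    W * (c * Nᵥ v vs K)
      ≤⟨ *-monoʳ-≤ W (C*Nᵥ≤ℓ*#extension ∣K∣≤s v∉K) ⟩
    W * (ℓ * #[ extension? G s (v ∷ vs) K ] (allSubsets n))
      ≤⟨ *-monoʳ-≤ W (*-monoʳ-≤ ℓ (#-mono _ _ drop-v (allSubsets n))) ⟩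
    W * (ℓ * M)
      ≡⟨ x∙yz≈y∙xz W ℓ M ⟩
    ℓ * (W * M)
      ≤⟨ *-monoʳ-≤ ℓ (W*#extension≤C*N ∣K∣≤s W≤N) ⟩
    ℓ * (((t ∸ ∣ K ∣) C (s ∸ ∣ K ∣)) * N vs K)
      ≤⟨ *-monoʳ-≤ ℓ (*-monoˡ-≤ (N vs K) c′≤[t∸∣K∣]*c) ⟩
    ℓ * ((t ∸ ∣ K ∣) * c * N vs K)
      ≡⟨ rearrange ℓ (t ∸ ∣ K ∣) c (N vs K) ⟩
    c * ((t ∸ ∣ K ∣) * ℓ * N vs K) ∎)
    where
    open ≤-Reasoning
    c : ℕ
    c = (t ∸ suc ∣ K ∣) C (s ∸ ∣ K ∣)
    M : ℕ
    M = #[ extension? G s vs K ] (allSubsets n)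
    0<c : 0 < c
    0<c = nCk>0 (∸-monoˡ-≤ (suc ∣ K ∣) s<t)
    c′≤[t∸∣K∣]*c : (t ∸ ∣ K ∣) C (s ∸ ∣ K ∣) ≤ (t ∸ ∣ K ∣) * c
    c′≤[t∸∣K∣]*c = subst (λ m → m C (s ∸ ∣ K ∣) ≤ m * c) (sym (+-∸-assoc 1 (<-≤-trans (s≤s ∣K∣≤s) s<t)))
                     ([1+n]Ck≤[1+n]*nCk (∸-monoˡ-≤ (suc ∣ K ∣) s<t))
    drop-v : ∀ {J} → Extension G s (v ∷ vs) K J → Extension G s vs K J
    drop-v (GJ , ∣J∣ , _ ∷ avJ , K⊆J) = GJ , ∣J∣ , avJ , K⊆J
    rearrange : ∀ l m c x → l * (m * c * x) ≡ c * (m * l * x)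
    rearrange = solve-∀

  module _ (D : ℕ) (D≤deg : ∀ {J} → G J ≡ true → ∣ J ∣ ≡ s → D ≤ deg t G J) where

    a : ℕ
    a = (t C s) * ℓ

    E : ℕ
    E = D ∸ a

    D*Nᵥ≤a*N : ∀ {v vs K} → 0 < ∣ K ∣ → ∣ K ∣ ≤ s → v ∉ K → (t C s) * (length vs * ℓ) ≤ D →
      D * Nᵥ v vs K ≤ a * N vs K
    D*Nᵥ≤a*N {v} {vs} {K} 0<∣K∣ ∣K∣≤s v∉K Cjℓ≤D = *-cancelˡ-≤ (t C s ∸ 1) {{>-nonZero 0<C∸1}} (begin
      (t C s ∸ 1) * (D * Nᵥ v vs K)
        ≡⟨ *-assoc (t C s ∸ 1) D _ ⟨
      (t C s ∸ 1) * D * Nᵥ v vs K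
        ≤⟨ *-monoˡ-≤ (Nᵥ v vs K) (c*y≤x⇒[c∸1]*x≤c*[x∸y] (t C s) D _ Cjℓ≤D) ⟩
      (t C s) * W * Nᵥ v vs K
        ≡⟨ *-assoc (t C s) W _ ⟩
      (t C s) * (W * Nᵥ v vs K)
        ≤⟨ *-monoʳ-≤ (t C s) (W*Nᵥ≤[t∸∣K∣]*ℓ*N ∣K∣≤s v∉K W≤N) ⟩
      (t C s) * ((t ∸ ∣ K ∣) * ℓ * N vs K)
        ≤⟨ *-monoʳ-≤ (t C s) (*-monoˡ-≤ (N vs K) (*-monoˡ-≤ ℓ t∸∣K∣≤C∸1)) ⟩
      (t C s) * ((t C s ∸ 1) * ℓ * N vs K)
        ≡⟨ rearrange (t C s) (t C s ∸ 1) ℓ (N vs K) ⟩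
      (t C s ∸ 1) * (a * N vs K) ∎)
      where
      open ≤-Reasoning
      W : ℕ
      W = D ∸ length vs * ℓ
      W≤N : ∀ {J} → Extension G s vs K J → W ≤ N vs J
      W≤N {J} (GJ , ∣J∣≡s , avJ , _) = m≤n+o⇒m∸n≤o D (length vs * ℓ)
        (≤-trans (D≤deg GJ ∣J∣≡s) (subst (deg t G J ≤_) (+-comm (N vs J) _) (deg≤N+∣vs∣*ℓ vs GJ ∣J∣≡s avJ)))
      t≤C : t ≤ (t C s)
      t≤C = n≤nCk 0<s s<t
      0<C∸1 : 0 < t C s ∸ 1
      0<C∸1 = m<n⇒0<n∸m (≤-trans (≤-trans (s≤s 0<s) s<t) t≤C)
      t∸∣K∣≤C∸1 : t ∸ ∣ K ∣ ≤ t C s ∸ 1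
      t∸∣K∣≤C∸1 = ≤-trans (∸-monoʳ-≤ t 0<∣K∣) (∸-monoˡ-≤ 1 t≤C)
      rearrange : ∀ c p l x → c * (p * l * x) ≡ p * (c * l * x)
      rearrange = solve-∀

    E*N≤D*N : ∀ {v vs K} → 0 < ∣ K ∣ → ∣ K ∣ ≤ s → v ∉ K → (t C s) * (length vs * ℓ) ≤ D →
      E * N vs K ≤ D * N (v ∷ vs) K
    E*N≤D*N {v} {vs} {K} 0<∣K∣ ∣K∣≤s v∉K Cjℓ≤D = begin
      E * N vs K
        ≡⟨ *-distribʳ-∸ (N vs K) D a ⟩
      D * N vs K ∸ a * N vs K
        ≡⟨ cong (λ m → D * m ∸ a * N vs K) (N-split v vs K) ⟩
      D * (N (v ∷ vs) K + Nᵥ v vs K) ∸ a * N vs K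
        ≡⟨ cong (_∸ a * N vs K) (*-distribˡ-+ D _ _) ⟩
      D * N (v ∷ vs) K + D * Nᵥ v vs K ∸ a * N vs K
        ≤⟨ ∸-monoˡ-≤ (a * N vs K) (+-monoʳ-≤ (D * N (v ∷ vs) K) (D*Nᵥ≤a*N 0<∣K∣ ∣K∣≤s v∉K Cjℓ≤D)) ⟩
      D * N (v ∷ vs) K + a * N vs K ∸ a * N vs K
        ≡⟨ m+n∸n≡m (D * N (v ∷ vs) K) (a * N vs K) ⟩
      D * N (v ∷ vs) K ∎
      where open ≤-Reasoning

    E^∣vs∣*N≤D^∣vs∣*N : ∀ vs {K} → Avoids vs K → 0 < ∣ K ∣ → ∣ K ∣ ≤ s → length vs * a ≤ E →
      E ^ length vs * N [] K ≤ D ^ length vs * N vs K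
    E^∣vs∣*N≤D^∣vs∣*N [] _ _ _ _ = ≤-refl
    E^∣vs∣*N≤D^∣vs∣*N (v ∷ vs) {K} (v∉K ∷ avK) 0<∣K∣ ∣K∣≤s [1+j]a≤E = begin
      E * E ^ j * N [] K         ≡⟨ *-assoc E (E ^ j) _ ⟩
      E * (E ^ j * N [] K)       ≤⟨ *-monoʳ-≤ E (E^∣vs∣*N≤D^∣vs∣*N vs avK 0<∣K∣ ∣K∣≤s ja≤E) ⟩
      E * (D ^ j * N vs K)       ≡⟨ x∙yz≈y∙xz E (D ^ j) _ ⟩
      D ^ j * (E * N vs K)       ≤⟨ *-monoʳ-≤ (D ^ j) (E*N≤D*N 0<∣K∣ ∣K∣≤s v∉K Cjℓ≤D) ⟩
      D ^ j * (D * N (v ∷ vs) K) ≡⟨ x∙yz≈y∙xz (D ^ j) D _ ⟩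
      D * (D ^ j * N (v ∷ vs) K) ≡⟨ *-assoc D (D ^ j) _ ⟨
      D * D ^ j * N (v ∷ vs) K   ∎
      where
      open ≤-Reasoning
      j : ℕ
      j = length vs
      ja≤E : j * a ≤ E
      ja≤E = ≤-trans (m≤n+m (j * a) a) [1+j]a≤E
      Cjℓ≤D : (t C s) * (j * ℓ) ≤ D
      Cjℓ≤D = ≤-trans (≤-reflexive (x∙yz≈y∙xz (t C s) j ℓ)) (≤-trans ja≤E (m∸n≤m D a))

    deg≤2*N : ∀ {r vs K} → Avoids vs K → 0 < ∣ K ∣ → ∣ K ∣ ≤ s → length vs ≤ r → 0 < r →
      a < D → D ^ r ≤ 2 * E ^ r → deg t G K ≤ 2 * N vs K
    deg≤2*N {r} {vs} {K} avK 0<∣K∣ ∣K∣≤s ∣vs∣≤r 0<r a<D bound =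
      *-cancelˡ-≤ (E ^ m) {{>-nonZero E^m>0}} (begin
        E ^ m * deg t G K        ≡⟨ cong (E ^ m *_) (deg≡#extension t G K) ⟩
        E ^ m * N [] K           ≤⟨ E^∣vs∣*N≤D^∣vs∣*N vs avK 0<∣K∣ ∣K∣≤s (≤-trans (*-monoˡ-≤ a ∣vs∣≤r) ra≤E) ⟩
        D ^ m * N vs K           ≤⟨ *-monoˡ-≤ (N vs K) (x^r≤2y^r⇒x^m≤2y^m 0<E (m∸n≤m D a) ∣vs∣≤r bound) ⟩
        2 * E ^ m * N vs K       ≡⟨ xy∙z≈y∙xz 2 (E ^ m) (N vs K) ⟩
        E ^ m * (2 * N vs K)     ∎)
      where
      open ≤-Reasoning
      m : ℕ
      m = length vs
      0<E : 0 < E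
      0<E = m<n⇒0<n∸m a<D
      E^m>0 : 0 < E ^ m
      E^m>0 = m^n>0 E {{>-nonZero 0<E}} m
      ra≤E : r * a ≤ E
      ra≤E = [x+y]^r≤2x^r⇒r*y≤x 0<E 0<r (subst (λ x → x ^ r ≤ 2 * E ^ r) (sym (m∸n+n≡m (<⇒≤ a<D))) bound)

    deg≤2*deg-∖ : ∀ {r S K} → ∣ S ∣ ≤ r → 0 < r → a < D → D ^ r ≤ 2 * E ^ r →
      (G ∖ S) K ≡ true → ∣ K ∣ ≤ s → deg t G K ≤ 2 * deg t (G ∖ S) K
    deg≤2*deg-∖ {r} {S} {K} ∣S∣≤r 0<r a<D bound K∈ ∣K∣≤s = begin
      deg t G K             ≤⟨ deg≤2*N (⊆∁⇒avoids-elements K⊆∁S) 0<∣K∣ ∣K∣≤s ∣elements∣≤r 0<r a<D bound ⟩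
      2 * N (elements S) K  ≤⟨ *-monoʳ-≤ 2 (#extension[elements]≤deg-∖ G-complex S (<-trans 0<s s<t) K) ⟩
      2 * deg t (G ∖ S) K   ∎
      where
      open ≤-Reasoning
      K⊆∁S : K ⊆ ∁ S
      K⊆∁S = proj₂ (∖-member G-complex S K∈)
      0<∣K∣ : 0 < ∣ K ∣
      0<∣K∣ = nonempty⇒∣p∣>0 (proj₁ (∖-isComplex G-complex S K K∈))
      ∣elements∣≤r : length (elements S) ≤ r
      ∣elements∣≤r = subst (_≤ r) (sym (length-elements S)) ∣S∣≤r

lookup-fromℕ≡last : ∀ {A : Set} {k} (xs : Vec A (suc k)) → lookup xs (fromℕ k) ≡ last xs
lookup-fromℕ≡last {k = zero}  (x ∷ [])     = refl
lookup-fromℕ≡last {k = suc k} (x ∷ y ∷ xs) = lookup-fromℕ≡last (y ∷ xs)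

lemma3p4 : ∀ {n} (t s ℓ r : ℕ) (B : Vec ℕ s) (G : Family n)
    → 0 < t → (s>0 : 0 < s) → 0 < ℓ → 0 < r → s < t
    → WeakBuilder t s ℓ B G
    → (t C s) * ℓ < lastEntry s>0 B ∸ ℓ
    → (lastEntry s>0 B ∸ ℓ) ^ r ≤ 2 * ((lastEntry s>0 B ∸ ℓ) ∸ (t C s) * ℓ) ^ r
    → StrongBuilderScaled t s ℓ r B 2 G
lemma3p4 t (suc s) ℓ r B G _ 0<s _ 0<r s<t (G-complex , lower , upper) a<D bound S _ ∣S∣≤r =
  ∖-isComplex G-complex S , lower-∖ , upper-∖
  where
  open Removal G-complex 0<s s<t upper
  D≤deg : ∀ {J} → G J ≡ true → ∣ J ∣ ≡ suc s → last B ∸ ℓ ≤ deg t G J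
  D≤deg {J} GJ ∣J∣≡ = ≤-trans (m∸n≤m (last B) ℓ) (subst₂ _≤_ (lookup-fromℕ≡last B) (*-identityˡ _)
                        (lower (fromℕ s) J GJ (trans ∣J∣≡ (cong suc (sym (toℕ-fromℕ s))))))
  lower-∖ : ∀ i K → (G ∖ S) K ≡ true → ∣ K ∣ ≡ suc (toℕ i) → lookup B i ≤ 2 * deg t (G ∖ S) K
  lower-∖ i K K∈ ∣K∣≡ = ≤-trans (lower i K (proj₁ (∖-member G-complex S K∈)) ∣K∣≡)
    (≤-trans (≤-reflexive (*-identityˡ _))
      (deg≤2*deg-∖ (last B ∸ ℓ) D≤deg ∣S∣≤r 0<r a<D bound K∈ (subst (_≤ suc s) (sym ∣K∣≡) (toℕ<n i))))
  upper-∖ : ∀ K → (G ∖ S) K ≡ true → ∣ K ∣ ≡ suc (suc s) → deg t (G ∖ S) K ≤ ℓ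
  upper-∖ K K∈ ∣K∣≡ = ≤-trans (deg-∖≤deg G-complex S K) (upper K (proj₁ (∖-member G-complex S K∈)) ∣K∣≡)
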